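{- If a formula $A$ derivable in $\mathsf{MLL}_{DI}$ is in normal form (negation is applied only to atoms), then the number of occurrences of $\wp$ in $A$ is one greater than the number of occurrences of $\otimes$ in $A$.
   Context: $\wp$ denotes par and $\otimes$ tensor. Formulae are built from atoms $\alpha_i$ and negated atoms $\overline{\alpha_i}$ using $\otimes$ and $\wp$; negation of compound formulae is defined by $\overline{A\otimes B}=\overline{A}\wp\overline{B}$, $\overline{A\wp B}=\overline{A}\otimes\overline{B}$. A context $S\{\ \}$ is a formula with one hole. The deep inference system $\mathsf{MLL}_{DI}$ has the axiom with conclusion $\overline{A}\wp A$ and the rules (premise $\to$ conclusion, $S$ arbitrary context): $S\{B\}\to S\{B\otimes(\overline{A}\wp A)\}$; $S\{(A\otimes\overline{A})\wp B\}\to S\{B\}$; $S\{A\wp B\}\to S\{B\wp A\}$; $S\{A\otimes B\}\to S\{B\otimes A\}$; $S\{A\wp(B\wp C)\}\to S\{(A\wp B)\wp C\}$; $S\{(A\otimes B)\otimes C\}\to S\{A\otimes(B\otimes C)\}$; $S\{A\otimes(B\wp C)\}\to S\{(A\otimes B)\wp C\}$. A formula is derivable if it ends a finite sequence starting with an axiom instance, each later formula obtained from the previous by a rule. -}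

module Defs where

open import Data.Nat using (ℕ; suc; _+_)
open import Data.Product using (∃-syntax)
open import Relation.Binary.PropositionalEquality using (_≡_)

-- Formulae of MLL: atoms α i, negated atoms ᾱ i, tensor and par.
-- Negation occurs only on atoms, so every formula is in normal form.
data Formula : Set where
  atom    : ℕ → Formula
  natom   : ℕ → Formula
  _⊗_     : Formula → Formula → Formula
  _⅋_     : Formula → Formula → Formula

infixr 6 _⊗_
infixr 5 _⅋_

neg : Formula → Formula
neg (atom i)  = natom i
neg (natom i) = atom i
neg (A ⊗ B)   = neg A ⅋ neg B
neg (A ⅋ B)   = neg A ⊗ neg B

data Context : Set where
  hole  : Context
  _⊗ₗ_  : Context → Formula → Context
  _⊗ᵣ_  : Formula → Context → Context
  _⅋ₗ_  : Context → Formula → Context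
  _⅋ᵣ_  : Formula → Context → Context

plug : Context → Formula → Formula
plug hole     F = F
plug (S ⊗ₗ B) F = plug S F ⊗ B
plug (A ⊗ᵣ S) F = A ⊗ plug S F
plug (S ⅋ₗ B) F = plug S F ⅋ B
plug (A ⅋ᵣ S) F = A ⅋ plug S F

-- Rules of MLL_DI at the root (premise, conclusion).
data RootStep : Formula → Formula → Set where
  ai↓  : ∀ A B   → RootStep B (B ⊗ (neg A ⅋ A))
  ai↑  : ∀ A B   → RootStep ((A ⊗ neg A) ⅋ B) B
  σ⅋   : ∀ A B   → RootStep (A ⅋ B) (B ⅋ A)
  σ⊗   : ∀ A B   → RootStep (A ⊗ B) (B ⊗ A)
  α⅋   : ∀ A B C → RootStep (A ⅋ (B ⅋ C)) ((A ⅋ B) ⅋ C)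
  α⊗   : ∀ A B C → RootStep ((A ⊗ B) ⊗ C) (A ⊗ (B ⊗ C))
  switch : ∀ A B C → RootStep (A ⊗ (B ⅋ C)) ((A ⊗ B) ⅋ C)

data Step : Formula → Formula → Set where
  step : ∀ S {P Q} → RootStep P Q → Step (plug S P) (plug S Q)

data Steps : Formula → Formula → Set where
  done : ∀ {A} → Steps A A
  _∷_  : ∀ {A B C} → Step A B → Steps B C → Steps A C

Derivable : Formula → Set
Derivable F = ∃[ A ] Steps (neg A ⅋ A) F

#⅋ : Formula → ℕ
#⅋ (atom _)  = 0
#⅋ (natom _) = 0
#⅋ (A ⊗ B)   = #⅋ A + #⅋ B
#⅋ (A ⅋ B)   = suc (#⅋ A + #⅋ B)

#⊗ : Formula → ℕ
#⊗ (atom _)  = 0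
#⊗ (natom _) = 0
#⊗ (A ⊗ B)   = suc (#⊗ A + #⊗ B)
#⊗ (A ⅋ B)   = #⊗ A + #⊗ B

-- The integer balance (number of ⅋ minus number of ⊗) is compositional and is
-- unchanged by every rule of MLL_DI, hence by every derivation. Since
-- negation swaps ⊗ and ⅋, the balance of an axiom  neg A ⅋ A  is
-- −b + b + 1 = 1, and so is the balance of every derivable formula.
module Submission where

open import Defs
open import Data.Nat using (suc)
open import Data.Integer using (ℤ; +_; _+_; _-_; -_; 0ℤ; 1ℤ)
open import Data.Integer.Properties using (+-comm; +-injective)
open import Data.Integer.Tactic.RingSolver using (solve-∀)
open import Data.Product using (_,_)
open import Relation.Binary.PropositionalEquality
  using (_≡_; refl; sym; trans; cong; cong₂; module ≡-Reasoning)

balance : Formula → ℤ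
balance (atom _)  = 0ℤ
balance (natom _) = 0ℤ
balance (A ⊗ B)   = balance A + balance B - 1ℤ
balance (A ⅋ B)   = balance A + balance B + 1ℤ

balance+#⊗≡#⅋ : ∀ F → balance F + + #⊗ F ≡ + #⅋ F
balance+#⊗≡#⅋ (atom _)  = refl
balance+#⊗≡#⅋ (natom _) = refl
balance+#⊗≡#⅋ (A ⊗ B)   =
  trans (regroup (balance A) (balance B) (+ #⊗ A) (+ #⊗ B))
        (cong₂ _+_ (balance+#⊗≡#⅋ A) (balance+#⊗≡#⅋ B))
  where
  regroup : ∀ a b x y → (a + b - 1ℤ) + (1ℤ + (x + y)) ≡ (a + x) + (b + y)
  regroup = solve-∀
balance+#⊗≡#⅋ (A ⅋ B)   =
  trans (regroup (balance A) (balance B) (+ #⊗ A) (+ #⊗ B))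
        (cong (λ n → 1ℤ + n) (cong₂ _+_ (balance+#⊗≡#⅋ A) (balance+#⊗≡#⅋ B)))
  where
  regroup : ∀ a b x y → (a + b + 1ℤ) + (x + y) ≡ 1ℤ + ((a + x) + (b + y))
  regroup = solve-∀

balance-neg : ∀ A → balance (neg A) ≡ - balance A
balance-neg (atom _)  = refl
balance-neg (natom _) = refl
balance-neg (A ⊗ B)   =
  trans (cong₂ (λ a b → a + b + 1ℤ) (balance-neg A) (balance-neg B))
        (negate (balance A) (balance B))
  where
  negate : ∀ a b → - a + - b + 1ℤ ≡ - (a + b - 1ℤ)
  negate = solve-∀
balance-neg (A ⅋ B)   =
  trans (cong₂ (λ a b → a + b - 1ℤ) (balance-neg A) (balance-neg B))
        (negate (balance A) (balance B))
  where
  negate : ∀ a b → - a + - b - 1ℤ ≡ - (a + b + 1ℤ)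
  negate = solve-∀

balance-axiom : ∀ A → balance (neg A ⅋ A) ≡ 1ℤ
balance-axiom A =
  trans (cong (λ n → n + balance A + 1ℤ) (balance-neg A)) (cancel (balance A))
  where
  cancel : ∀ a → - a + a + 1ℤ ≡ 1ℤ
  cancel = solve-∀

RootStep⇒balance≡ : ∀ {P Q} → RootStep P Q → balance P ≡ balance Q
RootStep⇒balance≡ (ai↓ A B) =
  sym (trans (cong (λ u → balance B + u - 1ℤ) (balance-axiom A)) (cancel (balance B)))
  where
  cancel : ∀ b → b + 1ℤ - 1ℤ ≡ b
  cancel = solve-∀
RootStep⇒balance≡ (ai↑ A B) =
  trans (cong (λ n → balance A + n - 1ℤ + balance B + 1ℤ) (balance-neg A))
        (cancel (balance A) (balance B))
  where
  cancel : ∀ a b → a + - a - 1ℤ + b + 1ℤ ≡ b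
  cancel = solve-∀
RootStep⇒balance≡ (σ⅋ A B) = cong (_+ 1ℤ) (+-comm (balance A) (balance B))
RootStep⇒balance≡ (σ⊗ A B) = cong (_- 1ℤ) (+-comm (balance A) (balance B))
RootStep⇒balance≡ (α⅋ A B C) = reassociate (balance A) (balance B) (balance C)
  where
  reassociate : ∀ a b c → a + (b + c + 1ℤ) + 1ℤ ≡ a + b + 1ℤ + c + 1ℤ
  reassociate = solve-∀
RootStep⇒balance≡ (α⊗ A B C) = reassociate (balance A) (balance B) (balance C)
  where
  reassociate : ∀ a b c → a + b - 1ℤ + c - 1ℤ ≡ a + (b + c - 1ℤ) - 1ℤ
  reassociate = solve-∀
RootStep⇒balance≡ (switch A B C) = regroup (balance A) (balance B) (balance C)
  where
  regroup : ∀ a b c → a + (b + c + 1ℤ) - 1ℤ ≡ a + b - 1ℤ + c + 1ℤ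
  regroup = solve-∀

balance-plug : ∀ S {P Q} → balance P ≡ balance Q →
               balance (plug S P) ≡ balance (plug S Q)
balance-plug hole     eq = eq
balance-plug (S ⊗ₗ B) eq = cong (λ s → s + balance B - 1ℤ) (balance-plug S eq)
balance-plug (A ⊗ᵣ S) eq = cong (λ s → balance A + s - 1ℤ) (balance-plug S eq)
balance-plug (S ⅋ₗ B) eq = cong (λ s → s + balance B + 1ℤ) (balance-plug S eq)
balance-plug (A ⅋ᵣ S) eq = cong (λ s → balance A + s + 1ℤ) (balance-plug S eq)

Steps⇒balance≡ : ∀ {P Q} → Steps P Q → balance P ≡ balance Q
Steps⇒balance≡ done                  = refl
Steps⇒balance≡ (step S rule ∷ steps) =
  trans (balance-plug S (RootStep⇒balance≡ rule)) (Steps⇒balance≡ steps)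

corollary3p5 : (A : Formula) → Derivable A → #⅋ A ≡ suc (#⊗ A)
corollary3p5 F (A , derivation) = +-injective (begin
  + #⅋ F             ≡⟨ balance+#⊗≡#⅋ F ⟨
  balance F + + #⊗ F ≡⟨ cong (_+ + #⊗ F) balance-F≡1 ⟩
  1ℤ + + #⊗ F        ∎)
  where
  open ≡-Reasoning
  balance-F≡1 : balance F ≡ 1ℤ
  balance-F≡1 = trans (sym (Steps⇒balance≡ derivation)) (balance-axiom A)
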